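{- Let $c$ be a well-formed GCL command and $f$ a label with $\mathsf{okf}(c,f)$, and let $P,Q$ be sets of stores. Suppose $an$ is a valid annotation of the automaton $\mathsf{aut}(c,f)$ for the specification $\{P\}\{Q\}$. Then the judgment $c:\{P\}\{Q\}$ is derivable in the proof system HL+, by a derivation whose assertions are built from the assertions $an(i)$ using boolean combinations with boolean expressions occurring in $c$ and with equality tests $pc=n$ of a fresh variable $pc$ against numeric literals, together with substitution instances $an(i)[x:=e]$ for assignments $x:=e$ occurring in $c$.
   Context: Stores are total maps from integer variables to $\mathbb{Z}$. GCL commands: $c ::= \mathsf{skip}^n \mid x :=^n e \mid c;c \mid \mathsf{if}^n\, gcs\,\mathsf{fi} \mid \mathsf{do}^n\, gcs\,\mathsf{od}$, $gcs ::= e\to c \mid e\to c \,\square\, gcs$ (nonempty), $n\in\mathbb{Z}$ labels, expressions always defined, boolean expressions built from primitive ones with $\wedge,\vee,\neg$; $\mathsf{enab}(gcs)$ is the disjunction of the guards. Well formed: well typed, and every $\mathsf{if}^n gcs\,\mathsf{fi}$ subcommand has $\mathsf{enab}(gcs)$ true in all stores. Denotation $[\![c]\!]$: standard big-step partial-correctness relation (identity for skip; update for assignment; composition; if chooses any enabled branch; do iterates enabled branches until $\mathsf{enab}(gcs)$ is false). $\mathsf{lab}(c)$ is the label of $c$ ($\mathsf{lab}(c;d)=\mathsf{lab}(c)$), $\mathsf{labs}(c)$ its set of labels, $\mathsf{okf}(c,f)$: labels in $c$ positive and pairwise distinct and $f\notin\mathsf{labs}(c)$; $\mathsf{sub}(n,c)$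 is the subcommand labelled $n$. Following successor $\mathsf{fsuc}$: $\mathsf{fsuc}(n,\mathsf{skip}^n,f)=\mathsf{fsuc}(n,x:=^ne,f)=\mathsf{fsuc}(n,\mathsf{if}^n\ldots,f)=\mathsf{fsuc}(n,\mathsf{do}^n\ldots,f)=f$; $\mathsf{fsuc}(n,c;d,f)=\mathsf{fsuc}(n,c,\mathsf{lab}(d))$ if $n\in\mathsf{labs}(c)$, else $\mathsf{fsuc}(n,d,f)$; for $m\in\mathsf{labs}(d)$, $e\to d$ in $gcs$: $\mathsf{fsuc}(m,\mathsf{if}^n gcs\,\mathsf{fi},f)=\mathsf{fsuc}(m,d,f)$, $\mathsf{fsuc}(m,\mathsf{do}^n gcs\,\mathsf{od},f)=\mathsf{fsuc}(m,d,n)$. Small steps: $\langle\mathsf{if}^n gcs\,\mathsf{fi},s\rangle\to\langle d,s\rangle$ and $\langle\mathsf{do}^n gcs\,\mathsf{od},s\rangle\to\langle d;\mathsf{do}^n gcs\,\mathsf{od},s\rangle$ for $e\to d\in gcs$ with $e$ true at $s$; $\langle\mathsf{do}^n gcs\,\mathsf{od},s\rangle\to\langle\mathsf{skip}^{ -n},s\rangle$ if $\mathsf{enab}(gcs)$ false; $\langle x:=^ne,s\rangle\to\langle\mathsf{skip}^{ -n},s[x\mapsto[\![e]\!](s)]\rangle$; $\langle\mathsf{skip}^n;c,s\rangle\to\langle c,s\rangle$; $\langle c;b,s\rangle\to\langle d;b,t\rangle$ if $\langle c,s\rangle\to\langle d,t\rangle$. The automaton $\mathsf{aut}(c,f)$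 has control points $\mathsf{labs}(c)\cup\{f\}$, stores as data, initial point $\mathsf{lab}(c)$, final point $f$, and $(n,s)\Rightarrow(m,t)$ iff $\langle\mathsf{sub}(n,c),s\rangle\to\langle d,t\rangle$ with ($\mathsf{lab}(d)>0$ and $m=\mathsf{lab}(d)$) or ($\mathsf{lab}(d)<0$ and $m=\mathsf{fsuc}(n,c,f)$), or $\mathsf{sub}(n,c)=\mathsf{skip}^n$, $m=\mathsf{fsuc}(n,c,f)$, $t=s$. An annotation for $\{P\}\{Q\}$ maps control points to sets of stores with $an(\mathsf{lab}(c))=P$, $an(f)=Q$; it is valid if $s\in an(n)$ and $(n,s)\Rightarrow(m,t)$ imply $t\in an(m)$. Assertions are sets of stores; a boolean expression $e$ denotes $\{s:[\![e]\!](s)=\mathrm{true}\}$; $s\in P[x:=e]$ iff $s[x\mapsto[\![e]\!](s)]\in P$; $\mathrm{indep}(x,P)$ means membership in $P$ does not depend on $x$; $\mathsf{ghost}(x,c)$: $x$ occurs in $c$ only in assignments to $x$; $\mathsf{erase}(x,c)$ replaces each assignment to $x$ by skip. HL+ rules: Rewrite (from $c:\{P\}\{Q\}$ and $c\cong d$ infer $d:\{P\}\{Q\}$); Ghost (from $c:\{P\}\{Q\}$, $\mathsf{ghost}(x,c)$, $\mathrm{indep}(x,P)$, $\mathrm{indep}(x,Q)$ infer $\mathsf{erase}(x,c):\{P\}\{Q\}$); Do (from $c:\{e\wedge P\}\{P\}$ for all $e\to c\in gcs$ infer $\mathsf{do}\,gcs\,\mathsf{od}:\{P\}\{P\wedge\neg\mathsf{enab}(gcs)\}$);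 Asgn ($x:=e:\{P[x:=e]\}\{P\}$); Skip ($\mathsf{skip}:\{P\}\{P\}$); Seq; If (from $c:\{e\wedge P\}\{Q\}$ for all $e\to c\in gcs$ infer $\mathsf{if}\,gcs\,\mathsf{fi}:\{P\}\{Q\}$); Conseq (with entailment as set inclusion); False ($c:\{\mathrm{false}\}\{P\}$). Here $c\cong d$ means $\mathrm{Hyp}\vdash\mathcal{K}(c)=\mathcal{K}(d)$ in Kleene algebra with tests, with $\mathcal{K}$ the standard translation ($\mathcal{K}(\mathsf{skip})=1$, $;\mapsto;$, $\mathcal{K}(\mathsf{if}\,gcs\,\mathsf{fi})=\sum_{e\to c\in gcs}\mathcal{K}(e);\mathcal{K}(c)$, $\mathcal{K}(\mathsf{do}\,gcs\,\mathsf{od})=(\sum_{e\to c\in gcs}\mathcal{K}(e);\mathcal{K}(c))^*;\neg\mathcal{K}(\mathsf{enab}(gcs))$, boolean connectives to test operations, primitive tests and assignments to atoms) and $\mathrm{Hyp}$ the equations $\mathcal{K}(e)=0$ for every unsatisfiable boolean $e$ and $\mathcal{K}(e_0);\mathcal{K}(x:=e);\neg\mathcal{K}(e_1)=0$ whenever $e_0\Rightarrow e_1[x:=e]$ is valid. -}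

module Defs where

open import Data.Bool using (Bool; true; false; if_then_else_; _∧_; _∨_; not)
open import Data.Nat as ℕ using (ℕ)
open import Data.Integer as ℤ using (ℤ; 0ℤ; _+_; _-_; _*_)
open import Data.List using (List; []; _∷_; [_]; _++_)
open import Data.List.Membership.Propositional using (_∈_; _∉_)
open import Data.List.Relation.Unary.All using (All)
open import Data.List.Relation.Unary.Unique.Propositional using (Unique)
open import Data.Product using (Σ; _×_; _,_)
open import Data.Sum using (_⊎_)
open import Data.Empty using (⊥)
open import Relation.Nullary using (¬_; does)
open import Relation.Binary.PropositionalEquality using (_≡_; _≗_; refl; cong; cong₂; sym; trans)

Var : Set
Var = ℕ

Store : Set
Store = Var → ℤ

upd : Store → Var → ℤ → Store
upd s x v y = if y ℕ.≡ᵇ x then v else s y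

data IExp : Set where
  lit   : ℤ → IExp
  var   : Var → IExp
  _⊞_   : IExp → IExp → IExp
  _⊟_   : IExp → IExp → IExp
  _⊠_   : IExp → IExp → IExp

data PrimB : Set where
  _≤ₑ_ : IExp → IExp → PrimB
  _=ₑ_ : IExp → IExp → PrimB

data BExp : Set where
  prim  : PrimB → BExp
  _and_ : BExp → BExp → BExp
  _or_  : BExp → BExp → BExp
  bnot  : BExp → BExp

evalI : IExp → Store → ℤ
evalI (lit z) s = z
evalI (var x) s = s x
evalI (a ⊞ b) s = evalI a s + evalI b s
evalI (a ⊟ b) s = evalI a s - evalI b s
evalI (a ⊠ b) s = evalI a s * evalI b s

evalP : PrimB → Store → Bool
evalP (a ≤ₑ b) s = does (evalI a s ℤ.≤? evalI b s)
evalP (a =ₑ b) s = does (evalI a s ℤ.≟ evalI b s)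

evalB : BExp → Store → Bool
evalB (prim p) s = evalP p s
evalB (a and b) s = evalB a s ∧ evalB b s
evalB (a or b) s = evalB a s ∨ evalB b s
evalB (bnot a) s = not (evalB a s)

substI : IExp → Var → IExp → IExp
substI (lit z) x e = lit z
substI (var y) x e = if y ℕ.≡ᵇ x then e else var y
substI (a ⊞ b) x e = substI a x e ⊞ substI b x e
substI (a ⊟ b) x e = substI a x e ⊟ substI b x e
substI (a ⊠ b) x e = substI a x e ⊠ substI b x e

substP : PrimB → Var → IExp → PrimB
substP (a ≤ₑ b) x e = substI a x e ≤ₑ substI b x e
substP (a =ₑ b) x e = substI a x e =ₑ substI b x e

substB : BExp → Var → IExp → BExp
substB (prim p) x e = prim (substP p x e)
substB (a and b) x e = substB a x e and substB b x e
substB (a or b) x e = substB a x e or substB b x e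
substB (bnot a) x e = bnot (substB a x e)

varsI : IExp → List Var
varsI (lit z) = []
varsI (var x) = [ x ]
varsI (a ⊞ b) = varsI a ++ varsI b
varsI (a ⊟ b) = varsI a ++ varsI b
varsI (a ⊠ b) = varsI a ++ varsI b

varsP : PrimB → List Var
varsP (a ≤ₑ b) = varsI a ++ varsI b
varsP (a =ₑ b) = varsI a ++ varsI b

varsB : BExp → List Var
varsB (prim p) = varsP p
varsB (a and b) = varsB a ++ varsB b
varsB (a or b) = varsB a ++ varsB b
varsB (bnot a) = varsB a

subB : BExp → List BExp
subB (prim p) = [ prim p ]
subB (a and b) = (a and b) ∷ subB a ++ subB b
subB (a or b) = (a or b) ∷ subB a ++ subB b
subB (bnot a) = bnot a ∷ subB a

mutual
  data Cmd : Set where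
    skip : ℤ → Cmd
    asgn : ℤ → Var → IExp → Cmd
    _⨾_  : Cmd → Cmd → Cmd
    ifc  : ℤ → GCs → Cmd
    doc  : ℤ → GCs → Cmd

  data GCs : Set where
    [_⇒_]   : BExp → Cmd → GCs
    _⇒_□_   : BExp → Cmd → GCs → GCs

branches : GCs → List (BExp × Cmd)
branches [ e ⇒ c ] = [ (e , c) ]
branches (e ⇒ c □ g) = (e , c) ∷ branches g

enab : GCs → BExp
enab [ e ⇒ c ] = e
enab (e ⇒ c □ g) = e or enab g

lab : Cmd → ℤ
lab (skip n) = n
lab (asgn n x e) = n
lab (c ⨾ d) = lab c
lab (ifc n g) = n
lab (doc n g) = n

mutual
  labs : Cmd → List ℤ
  labs (skip n) = [ n ]
  labs (asgn n x e) = [ n ]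
  labs (c ⨾ d) = labs c ++ labs d
  labs (ifc n g) = n ∷ labsG g
  labs (doc n g) = n ∷ labsG g

  labsG : GCs → List ℤ
  labsG [ e ⇒ c ] = labs c
  labsG (e ⇒ c □ g) = labs c ++ labsG g

mutual
  varsC : Cmd → List Var
  varsC (skip n) = []
  varsC (asgn n x e) = x ∷ varsI e
  varsC (c ⨾ d) = varsC c ++ varsC d
  varsC (ifc n g) = varsG g
  varsC (doc n g) = varsG g

  varsG : GCs → List Var
  varsG [ e ⇒ c ] = varsB e ++ varsC c
  varsG (e ⇒ c □ g) = varsB e ++ varsC c ++ varsG g

mutual
  bexpsC : Cmd → List BExp
  bexpsC (skip n) = []
  bexpsC (asgn n x e) = []
  bexpsC (c ⨾ d) = bexpsC c ++ bexpsC d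
  bexpsC (ifc n g) = bexpsG g
  bexpsC (doc n g) = bexpsG g

  bexpsG : GCs → List BExp
  bexpsG [ e ⇒ c ] = subB e ++ bexpsC c
  bexpsG (e ⇒ c □ g) = subB e ++ bexpsC c ++ bexpsG g

mutual
  asgnsC : Cmd → List (Var × IExp)
  asgnsC (skip n) = []
  asgnsC (asgn n x e) = [ (x , e) ]
  asgnsC (c ⨾ d) = asgnsC c ++ asgnsC d
  asgnsC (ifc n g) = asgnsG g
  asgnsC (doc n g) = asgnsG g

  asgnsG : GCs → List (Var × IExp)
  asgnsG [ e ⇒ c ] = asgnsC c
  asgnsG (e ⇒ c □ g) = asgnsC c ++ asgnsG g

-- Well formed: (well typed by construction and) every if has a guard
-- disjunction that is true in all stores.
data WF : Cmd → Set where
  wf-skip : ∀ {n} → WF (skip n)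
  wf-asgn : ∀ {n x e} → WF (asgn n x e)
  wf-seq  : ∀ {c d} → WF c → WF d → WF (c ⨾ d)
  wf-if   : ∀ {n g} → (∀ s → evalB (enab g) s ≡ true)
          → (∀ {e d} → (e , d) ∈ branches g → WF d) → WF (ifc n g)
  wf-do   : ∀ {n g} → (∀ {e d} → (e , d) ∈ branches g → WF d) → WF (doc n g)

OKF : Cmd → ℤ → Set
OKF c f = All (0ℤ ℤ.<_) (labs c) × Unique (labs c) × f ∉ labs c

data SubAt (n : ℤ) : Cmd → Cmd → Set where
  at-skip : SubAt n (skip n) (skip n)
  at-asgn : ∀ {x e} → SubAt n (asgn n x e) (asgn n x e)
  at-if   : ∀ {g} → SubAt n (ifc n g) (ifc n g)
  at-do   : ∀ {g} → SubAt n (doc n g) (doc n g)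
  in-seqˡ : ∀ {c d x} → SubAt n c x → SubAt n (c ⨾ d) x
  in-seqʳ : ∀ {c d x} → SubAt n d x → SubAt n (c ⨾ d) x
  in-if   : ∀ {m g e d x} → (e , d) ∈ branches g → SubAt n d x → SubAt n (ifc m g) x
  in-do   : ∀ {m g e d x} → (e , d) ∈ branches g → SubAt n d x → SubAt n (doc m g) x

-- FSuc n c f m : fsuc(n,c,f) = m (graph of the following-successor function)
data FSuc : ℤ → Cmd → ℤ → ℤ → Set where
  fs-skip : ∀ {n f} → FSuc n (skip n) f f
  fs-asgn : ∀ {n x e f} → FSuc n (asgn n x e) f f
  fs-if   : ∀ {n g f} → FSuc n (ifc n g) f f
  fs-do   : ∀ {n g f} → FSuc n (doc n g) f f
  fs-seqˡ : ∀ {n c d f m} → n ∈ labs c → FSuc n c (lab d) m → FSuc n (c ⨾ d) f m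
  fs-seqʳ : ∀ {n c d f m} → n ∉ labs c → FSuc n d f m → FSuc n (c ⨾ d) f m
  fs-inif : ∀ {m n g e d f k} → (e , d) ∈ branches g → m ∈ labs d
          → FSuc m d f k → FSuc m (ifc n g) f k
  fs-indo : ∀ {m n g e d f k} → (e , d) ∈ branches g → m ∈ labs d
          → FSuc m d n k → FSuc m (doc n g) f k

data Step : Cmd → Store → Cmd → Store → Set where
  st-if     : ∀ {n g e d s} → (e , d) ∈ branches g → evalB e s ≡ true
            → Step (ifc n g) s d s
  st-do     : ∀ {n g e d s} → (e , d) ∈ branches g → evalB e s ≡ true
            → Step (doc n g) s (d ⨾ doc n g) s
  st-doexit : ∀ {n g s} → evalB (enab g) s ≡ false
            → Step (doc n g) s (skip (ℤ.- n)) s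
  st-asgn   : ∀ {n x e s} → Step (asgn n x e) s (skip (ℤ.- n)) (upd s x (evalI e s))
  st-skip   : ∀ {n c s} → Step (skip n ⨾ c) s c s
  st-seq    : ∀ {c d b s t} → Step c s d t → Step (c ⨾ b) s (d ⨾ b) t

CP : Cmd → ℤ → ℤ → Set
CP c f i = i ∈ labs c ⊎ i ≡ f

data AutStep (c : Cmd) (f : ℤ) : ℤ → Store → ℤ → Store → Set where
  aut-pos  : ∀ {n s d d' t} → SubAt n c d → Step d s d' t → 0ℤ ℤ.< lab d'
           → AutStep c f n s (lab d') t
  aut-neg  : ∀ {n s d d' t m} → SubAt n c d → Step d s d' t → lab d' ℤ.< 0ℤ
           → FSuc n c f m → AutStep c f n s m t
  aut-skip : ∀ {n s m} → SubAt n c (skip n) → FSuc n c f m → AutStep c f n s m s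

-- Assertions: sets of stores (predicates, closed under pointwise equality
-- of stores, i.e. under extensional equality of total maps)

record Assertion : Set₁ where
  field
    holds : Store → Set
    resp  : ∀ {s t} → s ≗ t → holds s → holds t
open Assertion public

_⊆ₐ_ : Assertion → Assertion → Set
P ⊆ₐ Q = ∀ s → holds P s → holds Q s

_≐_ : Assertion → Assertion → Set
P ≐ Q = P ⊆ₐ Q × Q ⊆ₐ P

evalI-resp : ∀ e {s t} → s ≗ t → evalI e s ≡ evalI e t
evalI-resp (lit z) eq = refl
evalI-resp (var x) eq = eq x
evalI-resp (a ⊞ b) eq = cong₂ _+_ (evalI-resp a eq) (evalI-resp b eq)
evalI-resp (a ⊟ b) eq = cong₂ _-_ (evalI-resp a eq) (evalI-resp b eq)
evalI-resp (a ⊠ b) eq = cong₂ _*_ (evalI-resp a eq) (evalI-resp b eq)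

evalP-resp : ∀ p {s t} → s ≗ t → evalP p s ≡ evalP p t
evalP-resp (a ≤ₑ b) eq rewrite evalI-resp a eq | evalI-resp b eq = refl
evalP-resp (a =ₑ b) eq rewrite evalI-resp a eq | evalI-resp b eq = refl

evalB-resp : ∀ b {s t} → s ≗ t → evalB b s ≡ evalB b t
evalB-resp (prim p) eq = evalP-resp p eq
evalB-resp (a and b) eq = cong₂ _∧_ (evalB-resp a eq) (evalB-resp b eq)
evalB-resp (a or b) eq = cong₂ _∨_ (evalB-resp a eq) (evalB-resp b eq)
evalB-resp (bnot a) eq = cong not (evalB-resp a eq)

upd-resp : ∀ {s t} x v → s ≗ t → upd s x v ≗ upd t x v
upd-resp x v eq y with y ℕ.≡ᵇ x
... | true = refl
... | false = eq y

sym≗ : ∀ {s t : Store} → s ≗ t → t ≗ s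
sym≗ eq x = sym (eq x)

⟦_⟧ᵇ : BExp → Assertion
⟦ b ⟧ᵇ = record { holds = λ s → evalB b s ≡ true
                ; resp = λ eq h → trans (sym (evalB-resp b eq)) h }

_∧ₐ_ : Assertion → Assertion → Assertion
P ∧ₐ Q = record { holds = λ s → holds P s × holds Q s
                ; resp = λ { eq (p , q) → resp P eq p , resp Q eq q } }

_∨ₐ_ : Assertion → Assertion → Assertion
P ∨ₐ Q = record { holds = λ s → holds P s ⊎ holds Q s
                ; resp = λ { eq (Data.Sum.inj₁ p) → Data.Sum.inj₁ (resp P eq p)
                           ; eq (Data.Sum.inj₂ q) → Data.Sum.inj₂ (resp Q eq q) } }

¬ₐ_ : Assertion → Assertion
¬ₐ P = record { holds = λ s → ¬ holds P s
              ; resp = λ eq np p → np (resp P (sym≗ eq) p) }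

falseₐ : Assertion
falseₐ = record { holds = λ _ → ⊥ ; resp = λ _ () }

_[_≔_] : Assertion → Var → IExp → Assertion
P [ x ≔ e ] = record
  { holds = λ s → holds P (upd s x (evalI e s))
  ; resp = λ {s} {t} eq h → resp P (λ y → trans (cong (λ v → upd s x v y) (evalI-resp e eq))
                                                  (upd-resp x (evalI e t) eq y)) h }

Indep : Var → Assertion → Set
Indep x P = ∀ s v → (holds P s → holds P (upd s x v)) × (holds P (upd s x v) → holds P s)

IsAnnotation : Cmd → ℤ → (ℤ → Assertion) → Assertion → Assertion → Set
IsAnnotation c f an P Q = an (lab c) ≐ P × an f ≐ Q

ValidAnn : Cmd → ℤ → (ℤ → Assertion) → Set
ValidAnn c f an = ∀ {n s m t} → holds (an n) s → AutStep c f n s m t → holds (an m) t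

data Test : Set where
  tprim : PrimB → Test
  t0 t1 : Test
  _t∧_ _t∨_ : Test → Test → Test
  t¬ : Test → Test

data KTerm : Set where
  act  : Var → IExp → KTerm
  tst  : Test → KTerm
  k0 k1 : KTerm
  _⊕_ _⊙_ : KTerm → KTerm → KTerm
  _⋆ : KTerm → KTerm

infixl 6 _⊕_
infixl 7 _⊙_
infix 8 _⋆
infix 4 _≈ₖ_

KB : BExp → Test
KB (prim p) = tprim p
KB (a and b) = KB a t∧ KB b
KB (a or b) = KB a t∨ KB b
KB (bnot a) = t¬ (KB a)

mutual
  K : Cmd → KTerm
  K (skip n) = k1
  K (asgn n x e) = act x e
  K (c ⨾ d) = K c ⊙ K d
  K (ifc n g) = KG g
  K (doc n g) = (KG g) ⋆ ⊙ tst (t¬ (KB (enab g)))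

  KG : GCs → KTerm
  KG [ e ⇒ c ] = tst (KB e) ⊙ K c
  KG (e ⇒ c □ g) = tst (KB e) ⊙ K c ⊕ KG g

-- Hyp ⊢ p = q : derivability in the equational (Horn) theory of KAT
-- (Kozen's axioms; p ≤ q abbreviates p ⊕ q = q) extended with Hyp.
data _≈ₖ_ : KTerm → KTerm → Set where
  ≈refl  : ∀ {p} → p ≈ₖ p
  ≈sym   : ∀ {p q} → p ≈ₖ q → q ≈ₖ p
  ≈trans : ∀ {p q r} → p ≈ₖ q → q ≈ₖ r → p ≈ₖ r
  ⊕-cong : ∀ {p p' q q'} → p ≈ₖ p' → q ≈ₖ q' → p ⊕ q ≈ₖ p' ⊕ q'
  ⊙-cong : ∀ {p p' q q'} → p ≈ₖ p' → q ≈ₖ q' → p ⊙ q ≈ₖ p' ⊙ q'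
  ⋆-cong : ∀ {p p'} → p ≈ₖ p' → p ⋆ ≈ₖ p' ⋆
  ⊕-assoc : ∀ {p q r} → p ⊕ (q ⊕ r) ≈ₖ (p ⊕ q) ⊕ r
  ⊕-comm  : ∀ {p q} → p ⊕ q ≈ₖ q ⊕ p
  ⊕-zero  : ∀ {p} → p ⊕ k0 ≈ₖ p
  ⊕-idem  : ∀ {p} → p ⊕ p ≈ₖ p
  ⊙-assoc : ∀ {p q r} → p ⊙ (q ⊙ r) ≈ₖ (p ⊙ q) ⊙ r
  ⊙-idˡ   : ∀ {p} → k1 ⊙ p ≈ₖ p
  ⊙-idʳ   : ∀ {p} → p ⊙ k1 ≈ₖ p
  distribˡ : ∀ {p q r} → p ⊙ (q ⊕ r) ≈ₖ p ⊙ q ⊕ p ⊙ r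
  distribʳ : ∀ {p q r} → (p ⊕ q) ⊙ r ≈ₖ p ⊙ r ⊕ q ⊙ r
  annˡ : ∀ {p} → k0 ⊙ p ≈ₖ k0
  annʳ : ∀ {p} → p ⊙ k0 ≈ₖ k0
  unfoldˡ : ∀ {p} → (k1 ⊕ p ⊙ p ⋆) ⊕ p ⋆ ≈ₖ p ⋆
  unfoldʳ : ∀ {p} → (k1 ⊕ p ⋆ ⊙ p) ⊕ p ⋆ ≈ₖ p ⋆
  indˡ : ∀ {p q r} → (q ⊕ p ⊙ r) ⊕ r ≈ₖ r → p ⋆ ⊙ q ⊕ r ≈ₖ r
  indʳ : ∀ {p q r} → (q ⊕ r ⊙ p) ⊕ r ≈ₖ r → q ⊙ p ⋆ ⊕ r ≈ₖ r
  tst-∧ : ∀ {a b} → tst (a t∧ b) ≈ₖ tst a ⊙ tst b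
  tst-∨ : ∀ {a b} → tst (a t∨ b) ≈ₖ tst a ⊕ tst b
  tst-0 : tst t0 ≈ₖ k0
  tst-1 : tst t1 ≈ₖ k1
  tst-compl⊕ : ∀ {a} → tst (t¬ a) ⊕ tst a ≈ₖ k1
  tst-compl⊙ : ∀ {a} → tst (t¬ a) ⊙ tst a ≈ₖ k0
  tst-comm : ∀ {a b} → tst a ⊙ tst b ≈ₖ tst b ⊙ tst a
  tst-idem : ∀ {a} → tst a ⊙ tst a ≈ₖ tst a
  tst-≤1   : ∀ {a} → tst a ⊕ k1 ≈ₖ k1
  hyp-unsat : ∀ {e} → (∀ s → evalB e s ≡ false) → tst (KB e) ≈ₖ k0
  hyp-asgn  : ∀ {e₀ e₁ x e}
            → (∀ s → evalB e₀ s ≡ true → evalB (substB e₁ x e) s ≡ true)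
            → tst (KB e₀) ⊙ act x e ⊙ tst (t¬ (KB e₁)) ≈ₖ k0

_≅_ : Cmd → Cmd → Set
c ≅ d = K c ≈ₖ K d

mutual
  data Ghost (x : Var) : Cmd → Set where
    g-skip  : ∀ {n} → Ghost x (skip n)
    g-asgnx : ∀ {n e} → Ghost x (asgn n x e)
    g-asgn  : ∀ {n y e} → y ≢ x → x ∉ varsI e → Ghost x (asgn n y e)
    g-seq   : ∀ {c d} → Ghost x c → Ghost x d → Ghost x (c ⨾ d)
    g-if    : ∀ {n g} → (∀ {e d} → (e , d) ∈ branches g → x ∉ varsB e × Ghost x d)
            → Ghost x (ifc n g)
    g-do    : ∀ {n g} → (∀ {e d} → (e , d) ∈ branches g → x ∉ varsB e × Ghost x d)
            → Ghost x (doc n g)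

  _≢_ : Var → Var → Set
  y ≢ x = ¬ (y ≡ x)

mutual
  erase : Var → Cmd → Cmd
  erase x (skip n) = skip n
  erase x (asgn n y e) = if y ℕ.≡ᵇ x then skip n else asgn n y e
  erase x (c ⨾ d) = erase x c ⨾ erase x d
  erase x (ifc n g) = ifc n (eraseG x g)
  erase x (doc n g) = doc n (eraseG x g)

  eraseG : Var → GCs → GCs
  eraseG x [ e ⇒ c ] = [ e ⇒ erase x c ]
  eraseG x (e ⇒ c □ g) = e ⇒ erase x c □ eraseG x g

-- HL+ , with every assertion of the derivation required to satisfy G

data HL (G : Assertion → Set) : Cmd → Assertion → Assertion → Set₁ where
  hl-rewrite : ∀ {c d P Q} → G P → G Q → HL G c P Q → c ≅ d → HL G d P Q
  hl-ghost   : ∀ {c x P Q} → G P → G Q → HL G c P Q → Ghost x c → Indep x P → Indep x Q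
             → HL G (erase x c) P Q
  hl-do      : ∀ {n g P} → G P → G (P ∧ₐ ⟦ bnot (enab g) ⟧ᵇ)
             → (∀ {e c} → (e , c) ∈ branches g → HL G c (⟦ e ⟧ᵇ ∧ₐ P) P)
             → HL G (doc n g) P (P ∧ₐ ⟦ bnot (enab g) ⟧ᵇ)
  hl-asgn    : ∀ {n x e P} → G (P [ x ≔ e ]) → G P → HL G (asgn n x e) (P [ x ≔ e ]) P
  hl-skip    : ∀ {n P} → G P → HL G (skip n) P P
  hl-seq     : ∀ {c d P Q R} → G P → G R → HL G c P Q → HL G d Q R → HL G (c ⨾ d) P R
  hl-if      : ∀ {n g P Q} → G P → G Q
             → (∀ {e c} → (e , c) ∈ branches g → HL G c (⟦ e ⟧ᵇ ∧ₐ P) Q)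
             → HL G (ifc n g) P Q
  hl-conseq  : ∀ {c P P' Q Q'} → G P → G Q → P ⊆ₐ P' → HL G c P' Q' → Q' ⊆ₐ Q → HL G c P Q
  hl-false   : ∀ {c P} → G falseₐ → G P → HL G c falseₐ P

data Form (c : Cmd) (f : ℤ) : Set where
  ann    : (i : ℤ) → CP c f i → Form c f
  annSub : (i : ℤ) → CP c f i → (x : Var) (e : IExp) → (x , e) ∈ asgnsC c → Form c f
  bexp   : (b : BExp) → b ∈ bexpsC c → Form c f
  pcEq   : ℤ → Form c f
  _∧ᶠ_ _∨ᶠ_ : Form c f → Form c f → Form c f
  ¬ᶠ_    : Form c f → Form c f

⟦_⟧ᶠ : ∀ {c f} → Form c f → (ℤ → Assertion) → Var → Assertion
⟦ ann i _ ⟧ᶠ an pc = an i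
⟦ annSub i _ x e _ ⟧ᶠ an pc = an i [ x ≔ e ]
⟦ bexp b _ ⟧ᶠ an pc = ⟦ b ⟧ᵇ
⟦ pcEq n ⟧ᶠ an pc = ⟦ prim (var pc =ₑ lit n) ⟧ᵇ
⟦ φ ∧ᶠ ψ ⟧ᶠ an pc = ⟦ φ ⟧ᶠ an pc ∧ₐ ⟦ ψ ⟧ᶠ an pc
⟦ φ ∨ᶠ ψ ⟧ᶠ an pc = ⟦ φ ⟧ᶠ an pc ∨ₐ ⟦ ψ ⟧ᶠ an pc
⟦ ¬ᶠ φ ⟧ᶠ an pc = ¬ₐ ⟦ φ ⟧ᶠ an pc

Built : Cmd → ℤ → (ℤ → Assertion) → Var → Assertion → Set
Built c f an pc R = Σ (Form c f) λ φ → R ≐ ⟦ φ ⟧ᶠ an pc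

module Submission where

open import Defs

open import Data.Bool using (true; false; _∨_; not)
open import Data.Bool.Properties using (not-injective)
open import Data.Integer using (ℤ; 0ℤ; _<_; -_)
open import Data.Integer.Properties using (neg-mono-<)
open import Data.List using (List; _∷_; _++_)
open import Data.List.Membership.Propositional using (_∈_; _∉_)
open import Data.List.Membership.Propositional.Properties using (∈-++⁺ˡ; ∈-++⁺ʳ)
open import Data.List.Relation.Binary.Sublist.Propositional using (_⊆_; []; _∷_; _∷ʳ_; ⊆-refl; ⊆-trans; lookup)
open import Data.List.Relation.Binary.Sublist.Propositional.Properties using (++⁺ˡ; ++⁺ʳ; All-resp-⊆)
open import Data.List.Relation.Unary.All as All using (All)
open import Data.List.Relation.Unary.All.Properties using (++⁻ʳ)
open import Data.List.Relation.Unary.AllPairs using ([]; _∷_)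
open import Data.List.Relation.Unary.Any using (here; there)
open import Data.List.Relation.Unary.Unique.Propositional using (Unique)
open import Data.Product using (_,_; proj₁; proj₂; swap)
open import Data.Sum as Sum using (_⊎_; inj₁; inj₂; [_,_])
open import Data.Empty using (⊥-elim)
open import Function using (id; _∘_; const)
open import Function.Bundles using (_⇔_; mk⇔; Equivalence)
open import Relation.Nullary using (¬_)
open import Relation.Binary.PropositionalEquality using (_≡_; refl)

-- Instead of the paper's route (flatten c into one loop over a program counter pc,
-- then recover c by Rewrite and Ghost), the derivation follows the syntax of c.  Say
-- that a subcommand d of c occurs followed by k when fsuc computed inside d with final
-- point k agrees with fsuc in c; then d : {an (lab d)} {an k}, by induction on d.  Every
-- side condition is validity of an along one transition of aut(c,f): skip and assignment
-- steps lead to fsuc, choosing a branch of an if or a do leads to the label of that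
-- branch, and leaving a do leads to fsuc of the loop.

Unique-resp-⊇ : {A : Set} {xs ys : List A} → xs ⊆ ys → Unique ys → Unique xs
Unique-resp-⊇ [] [] = []
Unique-resp-⊇ (y ∷ʳ τ) (_ ∷ u) = Unique-resp-⊇ τ u
Unique-resp-⊇ (refl ∷ τ) (px ∷ u) = All-resp-⊆ τ px ∷ Unique-resp-⊇ τ u

Unique-++⇒∉ : {A : Set} (xs : List A) {ys : List A} {y : A}
            → Unique (xs ++ ys) → y ∈ ys → y ∉ xs
Unique-++⇒∉ (x ∷ xs) (px ∷ u) y∈ys (here refl) = All.lookup (++⁻ʳ xs px) y∈ys refl
Unique-++⇒∉ (x ∷ xs) (px ∷ u) y∈ys (there y∈xs) = Unique-++⇒∉ xs u y∈ys y∈xs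

lab∈labs : ∀ d → lab d ∈ labs d
lab∈labs (skip n) = here refl
lab∈labs (asgn n x e) = here refl
lab∈labs (c ⨾ d) = ∈-++⁺ˡ (lab∈labs c)
lab∈labs (ifc n g) = here refl
lab∈labs (doc n g) = here refl

e∈subB : ∀ e → e ∈ subB e
e∈subB (prim p) = here refl
e∈subB (a and b) = here refl
e∈subB (a or b) = here refl
e∈subB (bnot a) = here refl

guard∈bexpsG : ∀ {g e d} → (e , d) ∈ branches g → e ∈ bexpsG g
guard∈bexpsG {[ e ⇒ c ]} (here refl) = ∈-++⁺ˡ (e∈subB e)
guard∈bexpsG {e ⇒ c □ g} (here refl) = ∈-++⁺ˡ (e∈subB e)
guard∈bexpsG {e ⇒ c □ g} (there b) = ∈-++⁺ʳ (subB e) (∈-++⁺ʳ (bexpsC c) (guard∈bexpsG b))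

labs-branch : ∀ {g e d} → (e , d) ∈ branches g → labs d ⊆ labsG g
labs-branch {[ e ⇒ c ]} (here refl) = ⊆-refl
labs-branch {e ⇒ c □ g} (here refl) = ++⁺ʳ (labsG g) ⊆-refl
labs-branch {e ⇒ c □ g} (there b) = ++⁺ˡ (labs c) (labs-branch b)

asgns-branch : ∀ {g e d} → (e , d) ∈ branches g → asgnsC d ⊆ asgnsG g
asgns-branch {[ e ⇒ c ]} (here refl) = ⊆-refl
asgns-branch {e ⇒ c □ g} (here refl) = ++⁺ʳ (asgnsG g) ⊆-refl
asgns-branch {e ⇒ c □ g} (there b) = ++⁺ˡ (asgnsC c) (asgns-branch b)

bexps-branch : ∀ {g e d} → (e , d) ∈ branches g → bexpsC d ⊆ bexpsG g
bexps-branch {[ e ⇒ c ]} (here refl) = ++⁺ˡ (subB e) ⊆-refl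
bexps-branch {e ⇒ c □ g} (here refl) = ++⁺ˡ (subB e) (++⁺ʳ (bexpsG g) ⊆-refl)
bexps-branch {e ⇒ c □ g} (there b) = ++⁺ˡ (subB e) (++⁺ˡ (bexpsC c) (bexps-branch b))

∨≡true⇔ : ∀ x y → (x ∨ y ≡ true) ⇔ (x ≡ true ⊎ y ≡ true)
∨≡true⇔ true y = mk⇔ inj₁ (const refl)
∨≡true⇔ false y = mk⇔ inj₂ [ (λ ()) , id ]

not≡true⇔ : ∀ x → (not x ≡ true) ⇔ (¬ x ≡ true)
not≡true⇔ true = mk⇔ (λ ()) (λ x≢true → ⊥-elim (x≢true refl))
not≡true⇔ false = mk⇔ (λ _ ()) (const refl)

≐-refl : ∀ {P} → P ≐ P
≐-refl = (λ _ → id) , (λ _ → id)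

≐-trans : ∀ {P Q R} → P ≐ Q → Q ≐ R → P ≐ R
≐-trans (P⊆Q , Q⊆P) (Q⊆R , R⊆Q) = (λ s → Q⊆R s ∘ P⊆Q s) , (λ s → Q⊆P s ∘ R⊆Q s)

⟦or⟧ᵇ : ∀ a b → ⟦ a or b ⟧ᵇ ≐ (⟦ a ⟧ᵇ ∨ₐ ⟦ b ⟧ᵇ)
⟦or⟧ᵇ a b = (λ s → Equivalence.to (∨≡true⇔ (evalB a s) (evalB b s)))
          , (λ s → Equivalence.from (∨≡true⇔ (evalB a s) (evalB b s)))

⟦bnot⟧ᵇ : ∀ a → ⟦ bnot a ⟧ᵇ ≐ (¬ₐ ⟦ a ⟧ᵇ)
⟦bnot⟧ᵇ a = (λ s → Equivalence.to (not≡true⇔ (evalB a s)))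
          , (λ s → Equivalence.from (not≡true⇔ (evalB a s)))

module Occurrence (c : Cmd) (f : ℤ) where

  record Occurs (d : Cmd) (k : ℤ) : Set where
    field
      sub    : ∀ {m y} → SubAt m d y → SubAt m c y
      fsuc   : ∀ {m x} → m ∈ labs d → FSuc m d k x → FSuc m c f x
      labs⊆  : labs d ⊆ labs c
      asgns⊆ : asgnsC d ⊆ asgnsC c
      bexps⊆ : bexpsC d ⊆ bexpsC c
      next   : CP c f k

  open Occurs public

  occurs-root : Occurs c f
  occurs-root = record
    { sub = id ; fsuc = λ _ → id ; labs⊆ = ⊆-refl ; asgns⊆ = ⊆-refl ; bexps⊆ = ⊆-refl
    ; next = inj₂ refl }

  occurs-seqˡ : ∀ {d₁ d₂ k} → Occurs (d₁ ⨾ d₂) k → Occurs d₁ (lab d₂)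
  occurs-seqˡ {d₁} {d₂} o = record
    { sub = sub o ∘ in-seqˡ
    ; fsuc = λ m∈ fs → fsuc o (∈-++⁺ˡ m∈) (fs-seqˡ m∈ fs)
    ; labs⊆ = ⊆-trans (++⁺ʳ (labs d₂) ⊆-refl) (labs⊆ o)
    ; asgns⊆ = ⊆-trans (++⁺ʳ (asgnsC d₂) ⊆-refl) (asgns⊆ o)
    ; bexps⊆ = ⊆-trans (++⁺ʳ (bexpsC d₂) ⊆-refl) (bexps⊆ o)
    ; next = inj₁ (lookup (labs⊆ o) (∈-++⁺ʳ (labs d₁) (lab∈labs d₂))) }

  occurs-seqʳ : ∀ {d₁ d₂ k} → Unique (labs c) → Occurs (d₁ ⨾ d₂) k → Occurs d₂ k
  occurs-seqʳ {d₁} {d₂} uniq o = record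
    { sub = sub o ∘ in-seqʳ
    ; fsuc = λ m∈ fs → fsuc o (∈-++⁺ʳ (labs d₁) m∈) (fs-seqʳ (disjoint m∈) fs)
    ; labs⊆ = ⊆-trans (++⁺ˡ (labs d₁) ⊆-refl) (labs⊆ o)
    ; asgns⊆ = ⊆-trans (++⁺ˡ (asgnsC d₁) ⊆-refl) (asgns⊆ o)
    ; bexps⊆ = ⊆-trans (++⁺ˡ (bexpsC d₁) ⊆-refl) (bexps⊆ o)
    ; next = next o }
    where
    disjoint : ∀ {m} → m ∈ labs d₂ → m ∉ labs d₁
    disjoint = Unique-++⇒∉ (labs d₁) (Unique-resp-⊇ (labs⊆ o) uniq)

  occurs-if : ∀ {n g e d k} → Occurs (ifc n g) k → (e , d) ∈ branches g → Occurs d k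
  occurs-if {n} o b = record
    { sub = sub o ∘ in-if b
    ; fsuc = λ m∈ fs → fsuc o (there (lookup (labs-branch b) m∈)) (fs-inif b m∈ fs)
    ; labs⊆ = ⊆-trans (n ∷ʳ labs-branch b) (labs⊆ o)
    ; asgns⊆ = ⊆-trans (asgns-branch b) (asgns⊆ o)
    ; bexps⊆ = ⊆-trans (bexps-branch b) (bexps⊆ o)
    ; next = next o }

  occurs-do : ∀ {n g e d k} → Occurs (doc n g) k → (e , d) ∈ branches g → Occurs d n
  occurs-do {n} o b = record
    { sub = sub o ∘ in-do b
    ; fsuc = λ m∈ fs → fsuc o (there (lookup (labs-branch b) m∈)) (fs-indo b m∈ fs)
    ; labs⊆ = ⊆-trans (n ∷ʳ labs-branch b) (labs⊆ o)
    ; asgns⊆ = ⊆-trans (asgns-branch b) (asgns⊆ o)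
    ; bexps⊆ = ⊆-trans (bexps-branch b) (bexps⊆ o)
    ; next = inj₁ (lookup (labs⊆ o) (here refl)) }

  guard∈bexpsC : ∀ {g e d} → bexpsG g ⊆ bexpsC c → (e , d) ∈ branches g → e ∈ bexpsC c
  guard∈bexpsC τ b = lookup τ (guard∈bexpsG b)

  cp-lab : ∀ {d k} → Occurs d k → CP c f (lab d)
  cp-lab {d} o = inj₁ (lookup (labs⊆ o) (lab∈labs d))

  module Assertions (an : ℤ → Assertion) (pc : Var) where

    built-an : ∀ {i} → CP c f i → Built c f an pc (an i)
    built-an {i} i∈ = ann i i∈ , ≐-refl {an i}

    built-an-subst : ∀ {i x e} → CP c f i → (x , e) ∈ asgnsC c → Built c f an pc (an i [ x ≔ e ])
    built-an-subst {i} {x} {e} i∈ xe∈ = annSub i i∈ x e xe∈ , ≐-refl {an i [ x ≔ e ]}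

    built-resp : ∀ {P Q} → P ≐ Q → Built c f an pc Q → Built c f an pc P
    built-resp {P} {Q} P≐Q (φ , Q≐φ) = φ , ≐-trans {P} {Q} {⟦ φ ⟧ᶠ an pc} P≐Q Q≐φ

    built-∧ : ∀ {P Q} → Built c f an pc P → Built c f an pc Q → Built c f an pc (P ∧ₐ Q)
    built-∧ (φ , P⊆φ , φ⊆P) (ψ , Q⊆ψ , ψ⊆Q) =
      φ ∧ᶠ ψ , (λ s (p , q) → P⊆φ s p , Q⊆ψ s q) , (λ s (p , q) → φ⊆P s p , ψ⊆Q s q)

    built-∨ : ∀ {P Q} → Built c f an pc P → Built c f an pc Q → Built c f an pc (P ∨ₐ Q)
    built-∨ (φ , P⊆φ , φ⊆P) (ψ , Q⊆ψ , ψ⊆Q) =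
      φ ∨ᶠ ψ , (λ s → Sum.map (P⊆φ s) (Q⊆ψ s)) , (λ s → Sum.map (φ⊆P s) (ψ⊆Q s))

    built-¬ : ∀ {P} → Built c f an pc P → Built c f an pc (¬ₐ P)
    built-¬ (φ , P⊆φ , φ⊆P) = ¬ᶠ φ , (λ s ¬p → ¬p ∘ φ⊆P s) , (λ s ¬p → ¬p ∘ P⊆φ s)

    built-bexp : ∀ {e} → e ∈ bexpsC c → Built c f an pc ⟦ e ⟧ᵇ
    built-bexp {e} e∈ = bexp e e∈ , ≐-refl {⟦ e ⟧ᵇ}

    built-enab : ∀ g → (∀ {e d} → (e , d) ∈ branches g → e ∈ bexpsC c)
               → Built c f an pc ⟦ enab g ⟧ᵇ
    built-enab [ e ⇒ d ] guard∈ = built-bexp (guard∈ (here refl))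
    built-enab (e ⇒ d □ g) guard∈ =
      built-resp {⟦ e or enab g ⟧ᵇ} {⟦ e ⟧ᵇ ∨ₐ ⟦ enab g ⟧ᵇ} (⟦or⟧ᵇ e (enab g))
        (built-∨ {⟦ e ⟧ᵇ} {⟦ enab g ⟧ᵇ} (built-bexp (guard∈ (here refl)))
                                        (built-enab g (guard∈ ∘ there)))

    module Derivation (pos : All (0ℤ <_) (labs c)) (uniq : Unique (labs c)) (valid : ValidAnn c f an)
      where

      lab-pos : ∀ {d k} → Occurs d k → 0ℤ < lab d
      lab-pos {d} o = All.lookup pos (lookup (labs⊆ o) (lab∈labs d))

      neg-lab<0 : ∀ {d k} → Occurs d k → - lab d < 0ℤ
      neg-lab<0 o = neg-mono-< (lab-pos o)

      skip-valid : ∀ {n k} → Occurs (skip n) k → an n ⊆ₐ an k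
      skip-valid o s h = valid h (aut-skip (sub o at-skip) (fsuc o (here refl) fs-skip))

      asgn-valid : ∀ {n x e k} → Occurs (asgn n x e) k → an n ⊆ₐ (an k [ x ≔ e ])
      asgn-valid o s h =
        valid h (aut-neg (sub o at-asgn) st-asgn (neg-lab<0 o) (fsuc o (here refl) fs-asgn))

      if-entry-valid : ∀ {n g e d k} → Occurs (ifc n g) k → (e , d) ∈ branches g
                     → (⟦ e ⟧ᵇ ∧ₐ an n) ⊆ₐ an (lab d)
      if-entry-valid o b s (e✓ , h) =
        valid h (aut-pos (sub o at-if) (st-if b e✓) (lab-pos (occurs-if o b)))

      do-entry-valid : ∀ {n g e d k} → Occurs (doc n g) k → (e , d) ∈ branches g
                     → (⟦ e ⟧ᵇ ∧ₐ an n) ⊆ₐ an (lab d)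
      do-entry-valid o b s (e✓ , h) =
        valid h (aut-pos (sub o at-do) (st-do b e✓) (lab-pos (occurs-do o b)))

      do-exit-valid : ∀ {n g k} → Occurs (doc n g) k → (an n ∧ₐ ⟦ bnot (enab g) ⟧ᵇ) ⊆ₐ an k
      do-exit-valid o s (h , ¬enab) =
        valid h (aut-neg (sub o at-do) (st-doexit (not-injective {y = false} ¬enab))
                         (neg-lab<0 o) (fsuc o (here refl) fs-do))

      built-guarded : ∀ {e i} → e ∈ bexpsC c → CP c f i → Built c f an pc (⟦ e ⟧ᵇ ∧ₐ an i)
      built-guarded {e} {i} e∈ i∈ = built-∧ {⟦ e ⟧ᵇ} {an i} (built-bexp e∈) (built-an i∈)

      mutual
        occurs⇒triple : ∀ d {k} → Occurs d k → HL (Built c f an pc) d (an (lab d)) (an k)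
        occurs⇒triple (skip n) o =
          hl-conseq (built-an (cp-lab o)) (built-an (next o))
            (λ _ → id) (hl-skip {P = an n} (built-an (cp-lab o))) (skip-valid o)
        occurs⇒triple (asgn n x e) {k} o =
          hl-conseq (built-an (cp-lab o)) (built-an (next o)) (asgn-valid o)
            (hl-asgn {P = an k} (built-an-subst (next o) (lookup (asgns⊆ o) (here refl)))
                                (built-an (next o)))
            (λ _ → id)
        occurs⇒triple (d₁ ⨾ d₂) o =
          hl-seq (built-an (cp-lab o)) (built-an (next o))
            (occurs⇒triple d₁ (occurs-seqˡ o)) (occurs⇒triple d₂ (occurs-seqʳ uniq o))
        occurs⇒triple (ifc n g) o =
          hl-if (built-an (cp-lab o)) (built-an (next o)) λ b →
            hl-conseq (built-guarded (guard∈bexpsC (bexps⊆ o) b) (cp-lab o)) (built-an (next o))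
              (if-entry-valid o b) (branch-triple g b (occurs-if o b)) (λ _ → id)
        occurs⇒triple (doc n g) o =
          hl-conseq (built-an (cp-lab o)) (built-an (next o)) (λ _ → id)
            (hl-do {P = an n} (built-an (cp-lab o)) built-exit λ b →
              hl-conseq (built-guarded (guard∈bexpsC (bexps⊆ o) b) (cp-lab o)) (built-an (cp-lab o))
                (do-entry-valid o b) (branch-triple g b (occurs-do o b)) (λ _ → id))
            (do-exit-valid o)
          where
          built-exit : Built c f an pc (an n ∧ₐ ⟦ bnot (enab g) ⟧ᵇ)
          built-exit = built-∧ {an n} {⟦ bnot (enab g) ⟧ᵇ} (built-an (cp-lab o))
            (built-resp {⟦ bnot (enab g) ⟧ᵇ} {¬ₐ ⟦ enab g ⟧ᵇ} (⟦bnot⟧ᵇ (enab g))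
              (built-¬ {⟦ enab g ⟧ᵇ} (built-enab g (guard∈bexpsC (bexps⊆ o)))))

        branch-triple : ∀ g {e d k} → (e , d) ∈ branches g → Occurs d k
                      → HL (Built c f an pc) d (an (lab d)) (an k)
        branch-triple [ e ⇒ d ] (here refl) = occurs⇒triple d
        branch-triple (e ⇒ d □ g) (here refl) = occurs⇒triple d
        branch-triple (e ⇒ d □ g) (there b) = branch-triple g b

theorem6p1 : (c : Cmd) (f : ℤ) (P Q : Assertion) (an : ℤ → Assertion) (pc : Var)
    → WF c → OKF c f
    → IsAnnotation c f an P Q → ValidAnn c f an
    → pc ∉ varsC c → (∀ i → CP c f i → Indep pc (an i))
    → HL (Built c f an pc) c P Q
theorem6p1 c f P Q an pc _ (pos , uniq , _) (an≐P , an≐Q) valid _ _ =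
  hl-conseq (ann (lab c) (inj₁ (lab∈labs c)) , swap an≐P) (ann f (inj₂ refl) , swap an≐Q)
            (proj₂ an≐P) (occurs⇒triple c occurs-root) (proj₁ an≐Q)
  where
  open Occurrence c f
  open Assertions an pc
  open Derivation pos uniq valid
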